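{- Let $V$ be a finite non-empty set and $T:\mathscr{P}(V)\to\mathscr{P}(V)$ a map. If for some non-empty $Y$ in the range of $T$ the family $\{X\subseteq V: T(X)=Y\}$ has no least element with respect to $\subseteq$, then there is no pair $(E_1,E_2)$ of equivalence relations on $V$ with $T(X)=\mathbf{l}_{E_2}(\mathbf{l}_{E_1}(X))$ for all $X\subseteq V$.
   Context: For an equivalence relation $E$ on $V$: $\mathbf{l}_E(X)=\{x\in V:[x]_E\subseteq X\}$. -}

module Defs where

open import Level using (0ℓ)
open import Data.Nat using (ℕ; suc)
open import Data.Fin using (Fin)
open import Data.Fin.Subset using (Subset; _∈_; _⊆_; Nonempty)
open import Data.Product using (Σ; ∃; _×_; _,_)
open import Relation.Binary.Core using (Rel)
open import Relation.Binary.Structures using (IsEquivalence)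
open import Relation.Binary.PropositionalEquality using (_≡_)
open import Relation.Nullary using (¬_)
open import Function.Bundles using (_⇔_)

lowerP : ∀ {n} → Rel (Fin n) 0ℓ → (Fin n → Set) → (Fin n → Set)
lowerP E P x = ∀ y → E x y → P y

record EqRel (n : ℕ) : Set₁ where
  field
    rel   : Rel (Fin n) 0ℓ
    isEqv : IsEquivalence rel

IsLeastPreimage : ∀ {n} → (Subset n → Subset n) → Subset n → Subset n → Set
IsLeastPreimage T Y L = (T L ≡ Y) × (∀ X → T X ≡ Y → L ⊆ X)

IsDoubleLower : ∀ {n} → (Subset n → Subset n) → EqRel n → EqRel n → Set
IsDoubleLower T E₁ E₂ =
  ∀ X x → (x ∈ T X) ⇔ lowerP (EqRel.rel E₂) (lowerP (EqRel.rel E₁) (_∈ X)) x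

-- Writing u_E(P) = { x : ∃ y ∈ P, E y x } for the image of P under E, we have the Galois
-- connection u_E(P) ⊆ Q ⇔ P ⊆ l_E(Q) (for any relation E).  Composing two of them,
-- L := u_{E₁}(u_{E₂}(Y)) satisfies L ⊆ X ⇔ Y ⊆ l_{E₂}(l_{E₁}(X)).  Hence if T = l_{E₂} ∘ l_{E₁}
-- and Y = T(X₀), then L is the least preimage of Y: it lies below every preimage, and
-- Y ⊆ T(L) ⊆ T(X₀) = Y by the unit of the connection and monotonicity of T.  Forming L as a
-- subset needs membership to be decidable, which holds only up to double negation; this is
-- enough since the conclusion is a negation.
module Submission where

open import Defs
open import Level using (Level)
open import Data.Nat using (ℕ; suc; zero)
open import Data.Fin using (Fin)
import Data.Fin as Fin
open import Data.Fin.Subset using (Subset; Nonempty; _∈_; _⊆_)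
open import Data.Fin.Subset.Properties using (⊆-refl; ⊆-antisym)
open import Data.Product using (Σ; ∃; _×_; _,_)
open import Data.Bool using (true)
open import Data.Vec using (lookup; tabulate)
open import Data.Vec.Properties using ([]=⇒lookup; lookup⇒[]=; lookup∘tabulate)
open import Function.Bundles using (_⇔_; mk⇔; Equivalence)
open import Relation.Binary.Core using (Rel)
open import Relation.Binary.PropositionalEquality using (_≡_; sym; trans; subst)
open import Relation.Nullary using (¬_; Dec; yes; does)
open import Relation.Nullary.Decidable using (¬¬-excluded-middle; dec-true)
open import Relation.Unary using (Pred; Decidable)
import Relation.Unary as U

private
  variable
    ℓ : Level
    A : Set

image : Rel A ℓ → Pred A ℓ → Pred A ℓ
image E P x = ∃ λ y → P y × E y x

image⊆⇒⊆lowerP : ∀ {n} (E : Rel (Fin n) _) {P Q : Fin n → Set} →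
                 image E P U.⊆ Q → P U.⊆ lowerP E Q
image⊆⇒⊆lowerP E im⊆ p y e = im⊆ (_ , p , e)

⊆lowerP⇒image⊆ : ∀ {n} (E : Rel (Fin n) _) {P Q : Fin n → Set} →
                 P U.⊆ lowerP E Q → image E P U.⊆ Q
⊆lowerP⇒image⊆ E ⊆l (y , p , e) = ⊆l p _ e

lowerP-mono : ∀ {n} (E : Rel (Fin n) _) {P Q : Fin n → Set} →
              P U.⊆ Q → lowerP E P U.⊆ lowerP E Q
lowerP-mono E P⊆Q l y e = P⊆Q (l y e)

¬¬-decidable : ∀ n (P : Pred (Fin n) ℓ) → ¬ ¬ Decidable P
¬¬-decidable zero    P k = k (λ ())
¬¬-decidable (suc n) P k =
  ¬¬-excluded-middle λ d₀ → ¬¬-decidable n (λ x → P (Fin.suc x)) λ ds →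
    k λ { Fin.zero → d₀ ; (Fin.suc x) → ds x }

fromDecidable : ∀ {n} {P : Pred (Fin n) ℓ} → Decidable P → Subset n
fromDecidable P? = tabulate (λ x → does (P? x))

∈-fromDecidable : ∀ {n} {P : Pred (Fin n) ℓ} (P? : Decidable P) x → x ∈ fromDecidable P? ⇔ P x
∈-fromDecidable P? x = mk⇔
  (λ x∈ → does≡true⇒ (P? x) (trans (sym lookup≡does) ([]=⇒lookup x∈)))
  (λ p → lookup⇒[]= x _ (trans lookup≡does (dec-true (P? x) p)))
  where
  lookup≡does : lookup (fromDecidable P?) x ≡ does (P? x)
  lookup≡does = lookup∘tabulate (λ x → does (P? x)) x
  does≡true⇒ : ∀ {B : Set _} (B? : Dec B) → does B? ≡ true → B
  does≡true⇒ (yes b) _ = b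

module DoubleLower {n} (T : Subset n → Subset n) (E₁ E₂ : EqRel n) (T≡ll : IsDoubleLower T E₁ E₂) where
  open EqRel E₁ renaming (rel to R₁)
  open EqRel E₂ renaming (rel to R₂)

  doubleImage : Subset n → Pred (Fin n) _
  doubleImage Y = image R₁ (image R₂ (_∈ Y))

  doubleImage⊆⇒⊆T : ∀ Y X → doubleImage Y U.⊆ (_∈ X) → Y ⊆ T X
  doubleImage⊆⇒⊆T Y X im⊆ y∈Y = Equivalence.from (T≡ll X _)
    (image⊆⇒⊆lowerP R₂ (image⊆⇒⊆lowerP R₁ im⊆) y∈Y)

  ⊆T⇒doubleImage⊆ : ∀ Y X → Y ⊆ T X → doubleImage Y U.⊆ (_∈ X)
  ⊆T⇒doubleImage⊆ Y X Y⊆TX = ⊆lowerP⇒image⊆ R₁ (⊆lowerP⇒image⊆ R₂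
    (λ y∈Y → Equivalence.to (T≡ll X _) (Y⊆TX y∈Y)))

  T-mono : ∀ {X X′} → X ⊆ X′ → T X ⊆ T X′
  T-mono {X} {X′} X⊆X′ x∈TX = Equivalence.from (T≡ll X′ _)
    (lowerP-mono R₂ (lowerP-mono R₁ X⊆X′) (Equivalence.to (T≡ll X _) x∈TX))

  doubleImage-leastPreimage : ∀ {X₀ Y} → T X₀ ≡ Y → (L? : Decidable (doubleImage Y)) →
                              IsLeastPreimage T Y (fromDecidable L?)
  doubleImage-leastPreimage {X₀} {Y} TX₀≡Y L? = TL≡Y , L⊆preimage
    where
    L : Subset n
    L = fromDecidable L?

    L⊆preimage : ∀ X → T X ≡ Y → L ⊆ X
    L⊆preimage X TX≡Y {x} x∈L = ⊆T⇒doubleImage⊆ Y X (subst (Y ⊆_) (sym TX≡Y) ⊆-refl)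
      (Equivalence.to (∈-fromDecidable L? x) x∈L)

    TL≡Y : T L ≡ Y
    TL≡Y = ⊆-antisym (subst (T L ⊆_) TX₀≡Y (T-mono (L⊆preimage X₀ TX₀≡Y)))
                     (doubleImage⊆⇒⊆T Y L (λ {x} → Equivalence.from (∈-fromDecidable L? x)))

mainTheorem4 : (m : ℕ) → (T : Subset (suc m) → Subset (suc m)) → (Y : Subset (suc m))
    → Nonempty Y → (∃ λ X → T X ≡ Y) → ¬ (∃ λ L → IsLeastPreimage T Y L)
    → ¬ (Σ (EqRel (suc m)) λ E₁ → Σ (EqRel (suc m)) λ E₂ → IsDoubleLower T E₁ E₂)
mainTheorem4 m T Y _ (X₀ , TX₀≡Y) noLeast (E₁ , E₂ , T≡ll) =
  ¬¬-decidable (suc m) (doubleImage Y) λ L? →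
    noLeast (_ , doubleImage-leastPreimage TX₀≡Y L?)
  where open DoubleLower T E₁ E₂ T≡ll
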